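{- Let $d\ge1$, $n>d$ and let $T,T'\in L(n,d)$ with $T<T'$. Then for each $T_i\in T$ there exists a unique $T'_j\in T'$ such that $T'_j\subset T_i$.
   Context: For a finite set $X$ put $\operatorname{codim}_d(X)=d+1-|X|$. For a finite collection $\{T_1,\dots,T_l\}$ of pairwise distinct finite sets put $\rho_d(\{T_1,\dots,T_l\})=\sum_{i=1}^l\operatorname{codim}_d(T_i)$ (with $\rho_d(\emptyset)=0$) and $D_d(\{T_1,\dots,T_l\})=\operatorname{codim}_d(T_1\cap\cdots\cap T_l)-\rho_d(\{T_1,\dots,T_l\})$. For integers $d\ge1$, $n>d$, let $L(n,d)$ be the set of all $T\subset 2^{\{1,\dots,n\}}$ such that (1) $D_d(T')>0$ for every $T'\subset T$ with $|T'|>1$, and (2) $0\le |T_i|\le d$ for every $T_i\in T$. It is partially ordered by: $T<T'$ iff $\rho_d(T)<\rho_d(T')$ and for every $T_i\in T$ there exists $T'_j\in T'$ with $T'_j\subset T_i$. -}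

module Defs where

open import Data.Nat as ℕ using (ℕ; suc)
open import Data.Integer as ℤ using (ℤ; +_; _-_; _+_; _<_)
open import Data.List using (List; []; _∷_; length)
open import Data.List.Relation.Unary.All using (All)
open import Data.List.Relation.Unary.Unique.Propositional using (Unique)
open import Data.List.Membership.Propositional using (_∈_)
open import Data.Fin.Subset using (Subset; ⋂; ∣_∣) renaming (_⊆_ to _⊆ˢ_)
open import Data.Product using (Σ; _×_)

-- A finite collection of pairwise distinct subsets of {1,…,n} (= Fin n) is
-- represented by a duplicate-free list of subsets.

codim : ∀ {n} → ℕ → Subset n → ℤ
codim d X = + (suc d) - + ∣ X ∣

ρ : ∀ {n} → ℕ → List (Subset n) → ℤ
ρ d [] = + 0
ρ d (X ∷ Xs) = codim d X + ρ d Xs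

D : ∀ {n} → ℕ → List (Subset n) → ℤ
D d Ts = codim d (⋂ Ts) - ρ d Ts

_⊑_ : ∀ {n} → List (Subset n) → List (Subset n) → Set
T' ⊑ T = ∀ {X} → X ∈ T' → X ∈ T

InL : (n d : ℕ) → List (Subset n) → Set
InL n d T =
  Unique T ×
  (∀ (T' : List (Subset n)) → Unique T' → T' ⊑ T → 1 ℕ.< length T' → + 0 < D d T') ×
  All (λ X → ∣ X ∣ ℕ.≤ d) T

_≺[_]_ : ∀ {n} → List (Subset n) → ℕ → List (Subset n) → Set
T ≺[ d ] T' =
  ρ d T < ρ d T' ×
  (∀ {Ti} → Ti ∈ T → Σ (Subset _) λ Tj → Tj ∈ T' × Tj ⊆ˢ Ti)

module Submission where

-- Existence of a member of T' below a given T_i ∈ T is part of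
-- the definition of T < T'; only uniqueness needs an argument, and it uses
-- nothing but condition (1) for T' and condition (2) for T.
-- Condition (1) applied to a two-element sub-collection {A, B} of T' says
-- codim(A ∩ B) > codim A + codim B, i.e.  d + 1 + |A ∩ B| < |A| + |B|.
-- If A and B both lie inside a set C, inclusion–exclusion gives
-- |A| + |B| = |A ∪ B| + |A ∩ B| ≤ |C| + |A ∩ B|, hence d + 1 < |C|.
-- So two distinct members of T' never fit inside a set of size ≤ d + 1, and by
-- condition (2) every T_i ∈ T is such a set.

open import Defs
open import Data.Nat using (ℕ; _≤_; _<_)
open import Data.List using (List)
open import Data.List.Membership.Propositional using (_∈_)
open import Data.Fin.Subset using (Subset; _⊆_)
open import Data.Product using (Σ; _×_)
open import Relation.Binary.PropositionalEquality using (_≡_)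

open import Data.Nat as ℕ using (suc; z≤n; s≤s)
import Data.Nat.Properties as ℕP
open import Data.Integer as ℤ using (ℤ; +_; _⊖_)
import Data.Integer.Properties as ℤP
open import Data.Integer.Tactic.RingSolver using (solve-∀)
open import Data.List using ([]; _∷_; length)
open import Data.List.Relation.Unary.All as All using (All)
open import Data.List.Relation.Unary.Any using (here; there)
open import Data.List.Relation.Unary.AllPairs using ([]; _∷_)
open import Data.List.Relation.Unary.Unique.Propositional using (Unique)
open import Data.Fin.Subset using (_∩_; _∪_; ∣_∣; inside; outside)
open import Data.Fin.Subset.Properties using (∩-identityʳ; x∈p∪q⁻; p⊆q⇒∣p∣≤∣q∣)
open import Data.Vec.Base using ([]; _∷_)
open import Data.Vec.Properties using (≡-dec)
import Data.Bool.Properties as BoolP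
open import Data.Product using (_,_)
open import Data.Sum using ([_,_])
open import Data.Empty using (⊥-elim)
open import Relation.Nullary using (¬_; yes; no)
open import Relation.Binary.PropositionalEquality
  using (refl; sym; trans; cong; subst; module ≡-Reasoning)

∣p∪q∣+∣p∩q∣≡∣p∣+∣q∣ : ∀ {n} (p q : Subset n) → ∣ p ∪ q ∣ ℕ.+ ∣ p ∩ q ∣ ≡ ∣ p ∣ ℕ.+ ∣ q ∣
∣p∪q∣+∣p∩q∣≡∣p∣+∣q∣ []            []            = refl
∣p∪q∣+∣p∩q∣≡∣p∣+∣q∣ (outside ∷ p) (outside ∷ q) = ∣p∪q∣+∣p∩q∣≡∣p∣+∣q∣ p q
∣p∪q∣+∣p∩q∣≡∣p∣+∣q∣ (inside  ∷ p) (outside ∷ q) = cong suc (∣p∪q∣+∣p∩q∣≡∣p∣+∣q∣ p q)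
∣p∪q∣+∣p∩q∣≡∣p∣+∣q∣ (outside ∷ p) (inside  ∷ q) =
  trans (cong suc (∣p∪q∣+∣p∩q∣≡∣p∣+∣q∣ p q)) (sym (ℕP.+-suc ∣ p ∣ ∣ q ∣))
∣p∪q∣+∣p∩q∣≡∣p∣+∣q∣ (inside  ∷ p) (inside  ∷ q) = cong suc (begin
  ∣ p ∪ q ∣ ℕ.+ suc ∣ p ∩ q ∣  ≡⟨ ℕP.+-suc ∣ p ∪ q ∣ ∣ p ∩ q ∣ ⟩
  suc (∣ p ∪ q ∣ ℕ.+ ∣ p ∩ q ∣) ≡⟨ cong suc (∣p∪q∣+∣p∩q∣≡∣p∣+∣q∣ p q) ⟩
  suc (∣ p ∣ ℕ.+ ∣ q ∣)         ≡⟨ sym (ℕP.+-suc ∣ p ∣ ∣ q ∣) ⟩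
  ∣ p ∣ ℕ.+ suc ∣ q ∣           ∎)
  where open ≡-Reasoning

∣p∣+∣q∣≤∣r∣+∣p∩q∣ : ∀ {n} {p q r : Subset n} → p ⊆ r → q ⊆ r →
  ∣ p ∣ ℕ.+ ∣ q ∣ ≤ ∣ r ∣ ℕ.+ ∣ p ∩ q ∣
∣p∣+∣q∣≤∣r∣+∣p∩q∣ {p = p} {q} {r} p⊆r q⊆r =
  subst (_≤ ∣ r ∣ ℕ.+ ∣ p ∩ q ∣) (∣p∪q∣+∣p∩q∣≡∣p∣+∣q∣ p q)
    (ℕP.+-monoˡ-≤ ∣ p ∩ q ∣ (p⊆q⇒∣p∣≤∣q∣ p∪q⊆r))
  where
  p∪q⊆r : p ∪ q ⊆ r
  p∪q⊆r x∈p∪q = [ p⊆r , q⊆r ] (x∈p∪q⁻ p q x∈p∪q)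

D-pair : ∀ {n} d (A B : Subset n) →
  D d (A ∷ B ∷ []) ≡ (∣ A ∣ ℕ.+ ∣ B ∣) ⊖ (suc d ℕ.+ ∣ A ∩ B ∣)
D-pair d A B = begin
  D d (A ∷ B ∷ [])
    ≡⟨ cong (λ X → codim d (A ∩ X) ℤ.- ρ d (A ∷ B ∷ [])) (∩-identityʳ B) ⟩
  (+ suc d ℤ.- + ∣ A ∩ B ∣) ℤ.- ((+ suc d ℤ.- + ∣ A ∣) ℤ.+ ((+ suc d ℤ.- + ∣ B ∣) ℤ.+ + 0))
    ≡⟨ rearrange (+ suc d) (+ ∣ A ∣) (+ ∣ B ∣) (+ ∣ A ∩ B ∣) ⟩
  (+ ∣ A ∣ ℤ.+ + ∣ B ∣) ℤ.- (+ suc d ℤ.+ + ∣ A ∩ B ∣)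
    ≡⟨ ℤP.[+m]-[+n]≡m⊖n (∣ A ∣ ℕ.+ ∣ B ∣) (suc d ℕ.+ ∣ A ∩ B ∣) ⟩
  (∣ A ∣ ℕ.+ ∣ B ∣) ⊖ (suc d ℕ.+ ∣ A ∩ B ∣) ∎
  where
  open ≡-Reasoning
  rearrange : ∀ (e a b c : ℤ) →
    (e ℤ.- c) ℤ.- ((e ℤ.- a) ℤ.+ ((e ℤ.- b) ℤ.+ + 0)) ≡ (a ℤ.+ b) ℤ.- (e ℤ.+ c)
  rearrange = solve-∀

⊖-pos⇒> : ∀ {m n} → + 0 ℤ.< m ⊖ n → n < m
⊖-pos⇒> {m} {n} 0<m⊖n = ℕP.≰⇒> m≰n
  where
  m≰n : ¬ (m ≤ n)
  m≰n m≤n = ℤP.<⇒≱ 0<m⊖n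
    (subst (ℤ._≤ + 0) (sym (ℤP.⊖-≤ m≤n)) (ℤP.neg-mono-≤ (ℤ.+≤+ z≤n)))

D-pair-pos⇒ : ∀ {n} d (A B : Subset n) → + 0 ℤ.< D d (A ∷ B ∷ []) →
  suc d ℕ.+ ∣ A ∩ B ∣ < ∣ A ∣ ℕ.+ ∣ B ∣
D-pair-pos⇒ d A B 0<D = ⊖-pos⇒> (subst (+ 0 ℤ.<_) (D-pair d A B) 0<D)

no-small-common-superset : ∀ {n} d {A B C : Subset n} →
  + 0 ℤ.< D d (A ∷ B ∷ []) → A ⊆ C → B ⊆ C → suc d < ∣ C ∣
no-small-common-superset d {A} {B} {C} 0<D A⊆C B⊆C =
  ℕP.+-cancelʳ-< (∣ A ∩ B ∣) (suc d) (∣ C ∣) (ℕP.<-≤-trans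
    (D-pair-pos⇒ d A B 0<D) (∣p∣+∣q∣≤∣r∣+∣p∩q∣ A⊆C B⊆C))

PairwisePositive : ∀ {n} → ℕ → List (Subset n) → Set
PairwisePositive {n} d T =
  ∀ (T' : List (Subset n)) → Unique T' → T' ⊑ T → 1 ℕ.< length T' → + 0 ℤ.< D d T'

at-most-one-below : ∀ {n} d {T : List (Subset n)} {C A B : Subset n} →
  PairwisePositive d T → ∣ C ∣ ≤ suc d →
  A ∈ T → A ⊆ C → B ∈ T → B ⊆ C → A ≡ B
at-most-one-below d {T} {C} {A} {B} pos ∣C∣≤1+d A∈T A⊆C B∈T B⊆C
  with ≡-dec BoolP._≟_ A B
... | yes A≡B = A≡B
... | no  A≢B = ⊥-elim (ℕP.≤⇒≯ ∣C∣≤1+d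
      (no-small-common-superset d (pos (A ∷ B ∷ []) unique pair⊑T (s≤s (s≤s z≤n))) A⊆C B⊆C))
  where
  unique : Unique (A ∷ B ∷ [])
  unique = (A≢B All.∷ All.[]) ∷ (All.[] ∷ [])
  pair⊑T : (A ∷ B ∷ []) ⊑ T
  pair⊑T (here refl)         = A∈T
  pair⊑T (there (here refl)) = B∈T

proposition3p3 : (n d : ℕ) → 1 ≤ d → d < n →
    (T T' : List (Subset n)) → InL n d T → InL n d T' → T ≺[ d ] T' →
    ∀ {Ti} → Ti ∈ T →
      Σ (Subset n) λ Tj → (Tj ∈ T' × Tj ⊆ Ti) ×
        (∀ Tk → Tk ∈ T' → Tk ⊆ Ti → Tk ≡ Tj)
proposition3p3 n d _ _ T T' (_ , _ , small) (_ , pos' , _) (_ , below) {Ti} Ti∈T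
  with below Ti∈T
... | Tj , Tj∈T' , Tj⊆Ti = Tj , (Tj∈T' , Tj⊆Ti) , unique
  where
  unique : ∀ Tk → Tk ∈ T' → Tk ⊆ Ti → Tk ≡ Tj
  unique Tk Tk∈T' Tk⊆Ti =
    at-most-one-below d pos' (ℕP.m≤n⇒m≤1+n (All.lookup small Ti∈T)) Tk∈T' Tk⊆Ti Tj∈T' Tj⊆Ti
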